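{- For every integer $k \geq 4$, let $G$ be the tree constructed as follows. Take a vertex $v_0$ adjacent to three vertices $v_1, v_2, v_3$ (and to no other vertices). Attach to $v_1$ one pendant path with four vertices (new vertices $a_1,a_2,a_3,a_4$ with edges $v_1a_1, a_1a_2, a_2a_3, a_3a_4$) and two pendant paths with two vertices each; attach to $v_2$ exactly $k$ pendant paths with two vertices each, and to $v_3$ exactly $k+3$ pendant paths with two vertices each. Here attaching a pendant path $a b$ (a copy of $K_2$) to $v_i$ means adding new vertices $a, b$ and edges $v_i a$ and $a b$. Then the independence polynomial of $G$ is not log-concave.
   Context: An independent set in a graph is a set of pairwise non-adjacent vertices; $\alpha(G)$ denotes the maximum size of an independent set. The independence polynomial of $G$ is $I(G;x)=\sum_{k=0}^{\alpha(G)} s_k x^k$, where $s_k$ is the number of independent sets of size $k$ in $G$. A polynomial $\sum_{k=0}^{n} a_k x^k$ is called log-concave if its coefficient sequence satisfies $a_k^2 \geq a_{k-1}a_{k+1}$ for all $k\in\{1,\dots,n-1\}$. -}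

module Defs where

open import Data.Nat using (ℕ; zero; suc; _+_; _*_; _∸_; _≤_; _<_; _⊔_; _≡ᵇ_)
open import Data.Bool using (Bool; true; false; _∧_; not)
open import Data.List using (List; []; _∷_; _++_; map; foldr; filterᵇ; length; upTo; concatMap)
open import Data.List.Base using (applyUpTo)
open import Data.Vec using (Vec; []; _∷_)
open import Data.Fin.Subset using (Subset; ∣_∣)
open import Data.Product using (_×_; _,_)

-- Finite simple graphs: vertex set {0, …, n-1}, given by an edge list
-- (an edge (i , j) makes i and j adjacent).

record Graph : Set where
  constructor mkGraph
  field
    n : ℕ
    E : List (ℕ × ℕ)
open Graph public

addLeaf : Graph → ℕ → Graph
addLeaf (mkGraph n E) v = mkGraph (suc n) ((v , n) ∷ E)

attachPath : Graph → ℕ → ℕ → Graph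
attachPath g v zero    = g
attachPath g v (suc m) = attachPath (addLeaf g v) (n g) m

attachPaths : Graph → ℕ → ℕ → ℕ → Graph
attachPaths g v zero    m = g
attachPaths g v (suc c) m = attachPaths (attachPath g v m) v c m

-- The tree G(k): v₀ = 0 adjacent to v₁ = 1, v₂ = 2, v₃ = 3;
-- v₁ gets one pendant P₄ and two pendant K₂'s; v₂ gets k pendant K₂'s;
-- v₃ gets k+3 pendant K₂'s.
star : Graph
star = mkGraph 4 ((0 , 1) ∷ (0 , 2) ∷ (0 , 3) ∷ [])

treeG : ℕ → Graph
treeG k =
  attachPaths
    (attachPaths
      (attachPaths
        (attachPath star 1 4)
        1 2 2)
      2 k 2)
    3 (k + 3) 2

member : ∀ {m} → Subset m → ℕ → Bool
member []      _       = false
member (b ∷ s) zero    = b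
member (b ∷ s) (suc i) = member s i

isIndependent : (g : Graph) → Subset (n g) → Bool
isIndependent g S = foldr (λ { (i , j) r → not (member S i ∧ member S j) ∧ r }) true (E g)

allSubsets : (m : ℕ) → List (Subset m)
allSubsets zero    = [] ∷ []
allSubsets (suc m) = map (true ∷_) (allSubsets m) ++ map (false ∷_) (allSubsets m)

independentSets : (g : Graph) → List (Subset (n g))
independentSets g = filterᵇ (isIndependent g) (allSubsets (n g))

indepCount : Graph → ℕ → ℕ
indepCount g k = length (filterᵇ (λ S → ∣ S ∣ ≡ᵇ k) (independentSets g))

α : Graph → ℕ
α g = foldr _⊔_ 0 (map ∣_∣ (independentSets g))

indepPoly : Graph → List ℕ
indepPoly g = map (indepCount g) (upTo (suc (α g)))

coeff : List ℕ → ℕ → ℕ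
coeff []       _       = 0
coeff (a ∷ as) zero    = a
coeff (a ∷ as) (suc i) = coeff as i

LogConcave : List ℕ → Set
LogConcave as = ∀ k → 1 ≤ k → suc k < length as →
  coeff as (k ∸ 1) * coeff as (suc k) ≤ coeff as k * coeff as k

-- Condition on whether v₂ and v₃ lie in the independent set. A pendant K₂ at a vertex that is
-- in the set multiplies the conditioned independence polynomial by 1 + x, otherwise by 1 + 2x;
-- so each of the four conditioned polynomials is a polynomial of the subtree H spanned by
-- v₀, …, v₃ and the paths at v₁, times powers of 1 + x and 1 + 2x. Only the top three
-- coefficients matter: α(G) = 2k + 10 with s_α = 1 and s_{α−1} = 2k + 20 + 9·2^k, while the part
-- where neither v₂ nor v₃ is chosen alone contributes 13·2^{2k+3} = 104·4^k to s_{α−2}. Since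
-- s_{α−1}² ≈ 81·4^k, this gives s_{α−1}² < s_α s_{α−2} for k ≥ 4.

module Submission where

open import Defs
open import Data.Bool using (Bool; true; false; _∧_; not; if_then_else_; T)
open import Data.Bool.Properties using (∧-zeroʳ; ∧-identityʳ; ∧-assoc; ∧-comm)
open import Data.Nat
  using (ℕ; zero; suc; _+_; _*_; _^_; _∸_; _⊔_; _≤?_; _<?_; _≤_; _<_; _≡ᵇ_; z≤n; s≤s; s≤s⁻¹)
open import Data.Nat.Properties
open import Data.List using (List; []; _∷_; _++_; map; foldr; filterᵇ; length; upTo; applyUpTo)
open import Data.List.Properties using (length-++; length-map; length-upTo; filter-++)
open import Data.List.Membership.Propositional using (_∈_)
open import Data.List.Relation.Unary.All as All using (All; []; _∷_)
open import Data.List.Relation.Unary.Any using (here; there)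
open import Data.Product using (_×_; _,_)
open import Data.Vec using ([]; _∷_; _∷ʳ_)
open import Data.Fin.Subset using (Subset; ∣_∣)
open import Function using (_∘_; id)
open import Data.Nat.Tactic.RingSolver using (solve-∀)
open import Relation.Nullary using (¬_; contradiction; yes; no; ¬?)
open import Relation.Nullary.Decidable using (from-yes; from-no; _×-dec_)
open import Data.Fin.Subset.Properties using (anySubset?)
import Data.Bool as Bool
open import Relation.Binary.PropositionalEquality
open import Algebra.Properties.CommutativeSemigroup Data.Nat.Properties.+-commutativeSemigroup
  using (interchange)

-- Counting subsets by size

-- Polynomials are coefficient sequences ℕ → ℕ: shift f is x · f, and countOfSize P is
-- the sequence of Σ x^∣S∣ over the subsets S satisfying P.
shift : (ℕ → ℕ) → ℕ → ℕ
shift f zero    = 0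
shift f (suc j) = f j

shift-cong : ∀ {f g : ℕ → ℕ} → f ≗ g → shift f ≗ shift g
shift-cong e zero    = refl
shift-cong e (suc j) = e j

shift-+ : ∀ (f g : ℕ → ℕ) j → shift (λ i → f i + g i) j ≡ shift f j + shift g j
shift-+ f g zero    = refl
shift-+ f g (suc j) = refl

shift-zero : ∀ {f : ℕ → ℕ} → (∀ j → f j ≡ 0) → ∀ j → shift f j ≡ 0
shift-zero f≡0 zero    = refl
shift-zero f≡0 (suc j) = f≡0 j

countOfSize : ∀ {m} → (Subset m → Bool) → ℕ → ℕ
countOfSize {zero}  P zero    = if P [] then 1 else 0
countOfSize {zero}  P (suc j) = 0
countOfSize {suc m} P j =
  shift (countOfSize (P ∘ (true ∷_))) j + countOfSize (P ∘ (false ∷_)) j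

countOfSize-cong : ∀ {m} {P Q : Subset m → Bool} → P ≗ Q → countOfSize P ≗ countOfSize Q
countOfSize-cong {zero}  e zero    = cong (if_then 1 else 0) (e [])
countOfSize-cong {zero}  e (suc j) = refl
countOfSize-cong {suc m} e j =
  cong₂ _+_ (shift-cong (countOfSize-cong (e ∘ (true ∷_))) j)
            (countOfSize-cong (e ∘ (false ∷_)) j)

countOfSize-above : ∀ {m} (P : Subset m → Bool) j →
  (∀ S → P S ≡ true → ∣ S ∣ < j) → countOfSize P j ≡ 0
countOfSize-above {zero} P zero small with P [] in eq
... | true  with () ← small [] eq
... | false = refl
countOfSize-above {zero}  P (suc j) small = refl
countOfSize-above {suc m} P zero small =
  countOfSize-above (P ∘ (false ∷_)) zero (small ∘ (false ∷_))
countOfSize-above {suc m} P (suc j) small =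
  cong₂ _+_ (countOfSize-above (P ∘ (true ∷_)) j (λ S → s≤s⁻¹ ∘ small (true ∷ S)))
            (countOfSize-above (P ∘ (false ∷_)) (suc j) (small ∘ (false ∷_)))

countOfSize-none : ∀ {m} (P : Subset m → Bool) → (∀ S → P S ≡ false) →
  ∀ j → countOfSize P j ≡ 0
countOfSize-none P none j =
  countOfSize-above P j λ S e → contradiction (trans (sym e) (none S)) λ ()

countOfSize-snoc : ∀ {m} (P : Subset (suc m) → Bool) j →
  countOfSize P j ≡ shift (countOfSize (P ∘ (_∷ʳ true))) j + countOfSize (P ∘ (_∷ʳ false)) j
countOfSize-snoc {zero} P zero          = refl
countOfSize-snoc {zero} P (suc zero)    = refl
countOfSize-snoc {zero} P (suc (suc j)) = refl
countOfSize-snoc {suc m} P j = begin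
  shift (countOfSize (P ∘ (true ∷_))) j + countOfSize (P ∘ (false ∷_)) j
    ≡⟨ cong₂ _+_ (shift-cong (countOfSize-snoc (P ∘ (true ∷_))) j)
                 (countOfSize-snoc (P ∘ (false ∷_)) j) ⟩
  shift (λ i → shift TT i + TF i) j + (shift FT j + FF j)
    ≡⟨ cong (_+ (shift FT j + FF j)) (shift-+ (shift TT) TF j) ⟩
  (shift (shift TT) j + shift TF j) + (shift FT j + FF j)
    ≡⟨ interchange (shift (shift TT) j) (shift TF j) (shift FT j) (FF j) ⟩
  (shift (shift TT) j + shift FT j) + (shift TF j + FF j)
    ≡⟨ cong (_+ (shift TF j + FF j)) (shift-+ (shift TT) FT j) ⟨
  shift (λ i → shift TT i + FT i) j + (shift TF j + FF j) ∎
  where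
  open ≡-Reasoning
  TT TF FT FF : ℕ → ℕ
  TT = countOfSize λ S → P (true ∷ (S ∷ʳ true))
  TF = countOfSize λ S → P (true ∷ (S ∷ʳ false))
  FT = countOfSize λ S → P (false ∷ (S ∷ʳ true))
  FF = countOfSize λ S → P (false ∷ (S ∷ʳ false))

countOfSize-split : ∀ {m} (P Q : Subset m → Bool) j →
  countOfSize P j ≡ countOfSize (λ S → P S ∧ Q S) j + countOfSize (λ S → P S ∧ not (Q S)) j
countOfSize-split {zero} P Q zero with P [] | Q []
... | true  | true  = refl
... | true  | false = refl
... | false | _     = refl
countOfSize-split {zero}  P Q (suc j) = refl
countOfSize-split {suc m} P Q j = begin
  shift (countOfSize (P ∘ (true ∷_))) j + countOfSize (P ∘ (false ∷_)) j
    ≡⟨ cong₂ _+_ (shift-cong (countOfSize-split (P ∘ (true ∷_)) (Q ∘ (true ∷_))) j)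
                 (countOfSize-split (P ∘ (false ∷_)) (Q ∘ (false ∷_)) j) ⟩
  shift (λ i → Tyes i + Tno i) j + (Fyes j + Fno j)
    ≡⟨ cong (_+ (Fyes j + Fno j)) (shift-+ Tyes Tno j) ⟩
  (shift Tyes j + shift Tno j) + (Fyes j + Fno j)
    ≡⟨ interchange (shift Tyes j) (shift Tno j) (Fyes j) (Fno j) ⟩
  (shift Tyes j + Fyes j) + (shift Tno j + Fno j) ∎
  where
  open ≡-Reasoning
  Tyes Tno Fyes Fno : ℕ → ℕ
  Tyes = countOfSize λ S → P (true ∷ S) ∧ Q (true ∷ S)
  Tno  = countOfSize λ S → P (true ∷ S) ∧ not (Q (true ∷ S))
  Fyes = countOfSize λ S → P (false ∷ S) ∧ Q (false ∷ S)
  Fno  = countOfSize λ S → P (false ∷ S) ∧ not (Q (false ∷ S))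

module _ {A : Set} where

  length-filterᵇ-filterᵇ : ∀ (p q : A → Bool) xs →
    length (filterᵇ q (filterᵇ p xs)) ≡ length (filterᵇ (λ x → p x ∧ q x) xs)
  length-filterᵇ-filterᵇ p q [] = refl
  length-filterᵇ-filterᵇ p q (x ∷ xs) with p x
  ... | false = length-filterᵇ-filterᵇ p q xs
  ... | true with q x
  ...   | true  = cong suc (length-filterᵇ-filterᵇ p q xs)
  ...   | false = length-filterᵇ-filterᵇ p q xs

  length-filterᵇ-++ : ∀ (p : A → Bool) xs ys →
    length (filterᵇ p (xs ++ ys)) ≡ length (filterᵇ p xs) + length (filterᵇ p ys)
  length-filterᵇ-++ p xs ys = trans (cong length (filter-++ _ xs ys)) (length-++ (filterᵇ p xs))

  length-filterᵇ-map : ∀ {B : Set} (p : B → Bool) (f : A → B) xs →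
    length (filterᵇ p (map f xs)) ≡ length (filterᵇ (p ∘ f) xs)
  length-filterᵇ-map p f [] = refl
  length-filterᵇ-map p f (x ∷ xs) with p (f x)
  ... | true  = cong suc (length-filterᵇ-map p f xs)
  ... | false = length-filterᵇ-map p f xs

  length-filterᵇ-none : ∀ (p : A → Bool) → (∀ x → p x ≡ false) → ∀ xs → length (filterᵇ p xs) ≡ 0
  length-filterᵇ-none p none [] = refl
  length-filterᵇ-none p none (x ∷ xs) rewrite none x = length-filterᵇ-none p none xs

length-filterᵇ-allSubsets : ∀ m (P : Subset m → Bool) j →
  length (filterᵇ (λ S → P S ∧ (∣ S ∣ ≡ᵇ j)) (allSubsets m)) ≡ countOfSize P j
length-filterᵇ-allSubsets zero P zero with P []
... | true  = refl
... | false = refl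
length-filterᵇ-allSubsets zero P (suc j) with P []
... | true  = refl
... | false = refl
length-filterᵇ-allSubsets (suc m) P j = begin
  length (filterᵇ Q (map (true ∷_) (allSubsets m) ++ map (false ∷_) (allSubsets m)))
    ≡⟨ length-filterᵇ-++ Q (map (true ∷_) (allSubsets m)) (map (false ∷_) (allSubsets m)) ⟩
  length (filterᵇ Q (map (true ∷_) (allSubsets m))) + length (filterᵇ Q (map (false ∷_) (allSubsets m)))
    ≡⟨ cong₂ _+_ (length-filterᵇ-map Q (true ∷_) (allSubsets m))
                 (trans (length-filterᵇ-map Q (false ∷_) (allSubsets m))
                        (length-filterᵇ-allSubsets m (P ∘ (false ∷_)) j)) ⟩
  length (filterᵇ (Q ∘ (true ∷_)) (allSubsets m)) + countOfSize (P ∘ (false ∷_)) j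
    ≡⟨ cong (_+ countOfSize (P ∘ (false ∷_)) j) (inside j) ⟩
  shift (countOfSize (P ∘ (true ∷_))) j + countOfSize (P ∘ (false ∷_)) j ∎
  where
  open ≡-Reasoning
  Q : Subset (suc m) → Bool
  Q S = P S ∧ (∣ S ∣ ≡ᵇ j)
  inside : ∀ j → length (filterᵇ (λ S → P (true ∷ S) ∧ (suc ∣ S ∣ ≡ᵇ j)) (allSubsets m))
               ≡ shift (countOfSize (P ∘ (true ∷_))) j
  inside zero    = length-filterᵇ-none _ (λ S → ∧-zeroʳ (P (true ∷ S))) (allSubsets m)
  inside (suc j) = length-filterᵇ-allSubsets m (P ∘ (true ∷_)) j

indepCount≡countOfSize : ∀ g j → indepCount g j ≡ countOfSize (isIndependent g) j
indepCount≡countOfSize g j =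
  trans (length-filterᵇ-filterᵇ (isIndependent g) (λ S → ∣ S ∣ ≡ᵇ j) (allSubsets (n g)))
        (length-filterᵇ-allSubsets (n g) (isIndependent g) j)

-- A violation of log-concavity

coeff-map-applyUpTo : ∀ (f g : ℕ → ℕ) m i → i < m → coeff (map f (applyUpTo g m)) i ≡ f (g i)
coeff-map-applyUpTo f g (suc m) zero    _   = refl
coeff-map-applyUpTo f g (suc m) (suc i) i<m = coeff-map-applyUpTo f (g ∘ suc) m i (s≤s⁻¹ i<m)

≤-foldr-⊔-map : ∀ {A : Set} (f : A → ℕ) j xs → 0 < length (filterᵇ (λ x → f x ≡ᵇ j) xs) →
  j ≤ foldr _⊔_ 0 (map f xs)
≤-foldr-⊔-map f j (x ∷ xs) found with f x ≡ᵇ j in eq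
... | true  = ≤-trans (≤-reflexive (sym (≡ᵇ⇒≡ (f x) j (subst T (sym eq) _)))) (m≤m⊔n (f x) _)
... | false = ≤-trans (≤-foldr-⊔-map f j xs found) (m≤n⊔m (f x) _)

indepCount-pos⇒≤α : ∀ g j → 0 < indepCount g j → j ≤ α g
indepCount-pos⇒≤α g j = ≤-foldr-⊔-map ∣_∣ j (independentSets g)

¬logConcave-indepPoly : ∀ g h →
  indepCount g (1 + h) * indepCount g (1 + h) < indepCount g h * indepCount g (2 + h) → ¬ LogConcave (indepPoly g)
¬logConcave-indepPoly g h violated logConcave =
  <⇒≱ violated (subst₂ _≤_ (cong₂ _*_ (coeffAt h (m≤n+m h 2)) (coeffAt (2 + h) ≤-refl))
                           (cong₂ _*_ (coeffAt (1 + h) (m≤n+m _ 1)) (coeffAt (1 + h) (m≤n+m _ 1)))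
                           (logConcave (1 + h) (s≤s z≤n) inRange))
  where
  positive : ∀ {a} b c → a < b * c → 0 < c
  positive {a} b zero a<b*0 = contradiction (subst (a <_) (*-zeroʳ b) a<b*0) λ ()
  positive b (suc c) _ = s≤s z≤n
  2+h≤α : 2 + h ≤ α g
  2+h≤α = indepCount-pos⇒≤α g (2 + h) (positive (indepCount g h) (indepCount g (2 + h)) violated)
  coeffAt : ∀ i → i ≤ 2 + h → coeff (indepPoly g) i ≡ indepCount g i
  coeffAt i i≤ = coeff-map-applyUpTo (indepCount g) id (suc (α g)) i (s≤s (≤-trans i≤ 2+h≤α))
  inRange : 2 + h < length (indepPoly g)
  inRange = subst (2 + h <_) (sym (trans (length-map (indepCount g) (upTo (suc (α g)))) (length-upTo _)))
                  (s≤s 2+h≤α)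

-- Independent sets with prescribed vertices

EdgesBelow : ℕ → List (ℕ × ℕ) → Set
EdgesBelow m = All λ (i , j) → i < m × j < m

WellFormed : Graph → Set
WellFormed g = EdgesBelow (n g) (E g)

wellFormed-addLeaf : ∀ {g v} → WellFormed g → v < n g → WellFormed (addLeaf g v)
wellFormed-addLeaf {g} wf v<n =
  (m<n⇒m<1+n v<n , n<1+n (n g)) ∷ All.map (λ (i<n , j<n) → m<n⇒m<1+n i<n , m<n⇒m<1+n j<n) wf

matches : Bool → Bool → Bool
matches true  x = x
matches false x = not x

matches-self : ∀ b → matches b b ≡ true
matches-self true  = refl
matches-self false = refl

matches-not : ∀ b → matches (not b) b ≡ false
matches-not true  = refl
matches-not false = refl

satisfies : ∀ {m} → Subset m → List (ℕ × Bool) → Bool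
satisfies S []            = true
satisfies S ((v , b) ∷ β) = matches b (member S v) ∧ satisfies S β

ConstraintsBelow : ℕ → List (ℕ × Bool) → Set
ConstraintsBelow m = All λ (v , _) → v < m

indepCountWith : Graph → List (ℕ × Bool) → ℕ → ℕ
indepCountWith g β = countOfSize λ S → isIndependent g S ∧ satisfies S β

indepCount≡indepCountWith[] : ∀ g j → indepCount g j ≡ indepCountWith g [] j
indepCount≡indepCountWith[] g j =
  trans (indepCount≡countOfSize g j)
        (countOfSize-cong (λ S → sym (∧-identityʳ (isIndependent g S))) j)

indepCountWith-condition : ∀ g β v j →
  indepCountWith g β j ≡ indepCountWith g ((v , true) ∷ β) j + indepCountWith g ((v , false) ∷ β) j
indepCountWith-condition g β v j =
  trans (countOfSize-split (λ S → isIndependent g S ∧ satisfies S β) (λ S → member S v) j)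
        (cong₂ _+_ (countOfSize-cong (λ S → shuffle (isIndependent g S) (member S v) (satisfies S β)) j)
                   (countOfSize-cong (λ S → shuffle (isIndependent g S) (not (member S v)) (satisfies S β)) j))
  where
  shuffle : ∀ a b c → (a ∧ c) ∧ b ≡ a ∧ (b ∧ c)
  shuffle a b c = trans (∧-assoc a c b) (cong (a ∧_) (∧-comm c b))

member-∷ʳ : ∀ {m} (S : Subset m) c {i} → i < m → member (S ∷ʳ c) i ≡ member S i
member-∷ʳ (b ∷ S) c {zero}  _   = refl
member-∷ʳ (b ∷ S) c {suc i} i<m = member-∷ʳ S c (s≤s⁻¹ i<m)

member-∷ʳ-last : ∀ {m} (S : Subset m) c → member (S ∷ʳ c) m ≡ c
member-∷ʳ-last []      c = refl
member-∷ʳ-last (b ∷ S) c = member-∷ʳ-last S c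

isIndependent-∷ʳ : ∀ {m} {L : List (ℕ × ℕ)} → EdgesBelow m L → (S : Subset m) → ∀ c →
  isIndependent (mkGraph (suc m) L) (S ∷ʳ c) ≡ isIndependent (mkGraph m L) S
isIndependent-∷ʳ []                 S c = refl
isIndependent-∷ʳ ((i<m , j<m) ∷ ok) S c =
  cong₂ (λ both rest → not both ∧ rest)
        (cong₂ _∧_ (member-∷ʳ S c i<m) (member-∷ʳ S c j<m)) (isIndependent-∷ʳ ok S c)

satisfies-∷ʳ : ∀ {m β} → ConstraintsBelow m β → (S : Subset m) → ∀ c → satisfies (S ∷ʳ c) β ≡ satisfies S β
satisfies-∷ʳ []          S c = refl
satisfies-∷ʳ {β = (v , b) ∷ _} (v<m ∷ ok) S c =
  cong₂ (λ x rest → matches b x ∧ rest) (member-∷ʳ S c v<m) (satisfies-∷ʳ ok S c)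

isIndependent-addLeaf : ∀ {g v} → WellFormed g → v < n g → (S : Subset (n g)) → ∀ c →
  isIndependent (addLeaf g v) (S ∷ʳ c) ≡ not (member S v ∧ c) ∧ isIndependent g S
isIndependent-addLeaf wf v<n S c =
  cong₂ (λ both rest → not both ∧ rest)
        (cong₂ _∧_ (member-∷ʳ S c v<n) (member-∷ʳ-last S c)) (isIndependent-∷ʳ wf S c)

indepCountWith-addLeaf : ∀ {g v β} → WellFormed g → v < n g → ConstraintsBelow (n g) β → ∀ j →
  indepCountWith (addLeaf g v) β j ≡ shift (indepCountWith g ((v , false) ∷ β)) j + indepCountWith g β j
indepCountWith-addLeaf {g} {v} {β} wf v<n ok j =
  trans (countOfSize-snoc (λ S → isIndependent (addLeaf g v) S ∧ satisfies S β) j)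
        (cong₂ _+_ (shift-cong (countOfSize-cong leafIn) j) (countOfSize-cong leafOut j))
  where
  leafIn : ∀ S → isIndependent (addLeaf g v) (S ∷ʳ true) ∧ satisfies (S ∷ʳ true) β
               ≡ isIndependent g S ∧ (not (member S v) ∧ satisfies S β)
  leafIn S rewrite isIndependent-addLeaf wf v<n S true | satisfies-∷ʳ ok S true
                 | ∧-identityʳ (member S v) =
    trans (cong (_∧ satisfies S β) (∧-comm (not (member S v)) (isIndependent g S)))
          (∧-assoc (isIndependent g S) (not (member S v)) (satisfies S β))
  leafOut : ∀ S → isIndependent (addLeaf g v) (S ∷ʳ false) ∧ satisfies (S ∷ʳ false) β
                ≡ isIndependent g S ∧ satisfies S β
  leafOut S rewrite isIndependent-addLeaf wf v<n S false | satisfies-∷ʳ ok S false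
                  | ∧-zeroʳ (member S v) = refl

indepCountWith-addLeaf-excluded : ∀ {g v β} → WellFormed g → v < n g → ConstraintsBelow (n g) β → ∀ j →
  indepCountWith (addLeaf g v) ((n g , false) ∷ β) j ≡ indepCountWith g β j
indepCountWith-addLeaf-excluded {g} {v} {β} wf v<n ok j =
  trans (countOfSize-snoc (λ S → isIndependent (addLeaf g v) S ∧ satisfies S ((n g , false) ∷ β)) j)
        (cong₂ _+_ (shift-zero (countOfSize-none _ leafIn) j) (countOfSize-cong leafOut j))
  where
  leafIn : ∀ S → isIndependent (addLeaf g v) (S ∷ʳ true) ∧ satisfies (S ∷ʳ true) ((n g , false) ∷ β)
               ≡ false
  leafIn S rewrite member-∷ʳ-last S true = ∧-zeroʳ _
  leafOut : ∀ S → isIndependent (addLeaf g v) (S ∷ʳ false) ∧ satisfies (S ∷ʳ false) ((n g , false) ∷ β)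
                ≡ isIndependent g S ∧ satisfies S β
  leafOut S rewrite isIndependent-addLeaf wf v<n S false | satisfies-∷ʳ ok S false
                  | member-∷ʳ-last S false | ∧-zeroʳ (member S v) = refl

satisfies-∈ : ∀ {m} (S : Subset m) {v b β} → (v , b) ∈ β → satisfies S β ≡ true → member S v ≡ b
satisfies-∈ S {β = (v , b) ∷ β} (here refl) sat with b | member S v
... | true  | true  = refl
... | false | false = refl
... | true  | false = contradiction sat λ ()
... | false | true  = contradiction sat λ ()
satisfies-∈ S {β = (w , c) ∷ β} (there v∈β) sat with matches c (member S w)
... | true  = satisfies-∈ S v∈β sat
... | false = contradiction sat λ ()

indepCountWith-conflict : ∀ g {v b β} → (v , b) ∈ β → ∀ j → indepCountWith g ((v , not b) ∷ β) j ≡ 0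
indepCountWith-conflict g {v} {b} {β} v∈β = countOfSize-none _ conflict
  where
  conflict : ∀ S → isIndependent g S ∧ (matches (not b) (member S v) ∧ satisfies S β) ≡ false
  conflict S with satisfies S β in sat
  ... | false = trans (cong (isIndependent g S ∧_) (∧-zeroʳ _)) (∧-zeroʳ _)
  ... | true rewrite satisfies-∈ S v∈β sat | matches-not b = ∧-zeroʳ _

indepCountWith-redundant : ∀ g {v b β} → (v , b) ∈ β →
  ∀ j → indepCountWith g ((v , b) ∷ β) j ≡ indepCountWith g β j
indepCountWith-redundant g {v} {b} {β} v∈β = countOfSize-cong λ S → cong (isIndependent g S ∧_) (redundant S)
  where
  redundant : ∀ S → matches b (member S v) ∧ satisfies S β ≡ satisfies S β
  redundant S with satisfies S β in sat
  ... | false = ∧-zeroʳ _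
  ... | true rewrite satisfies-∈ S v∈β sat | matches-self b = refl

-- Pendant K₂'s

mulLinear : ℕ → (ℕ → ℕ) → ℕ → ℕ
mulLinear c f j = f j + c * shift f j

mulLinear^ : ℕ → ℕ → (ℕ → ℕ) → ℕ → ℕ
mulLinear^ c zero    f = f
mulLinear^ c (suc r) f = mulLinear^ c r (mulLinear c f)

mulLinear^-cong : ∀ c r {f g : ℕ → ℕ} → f ≗ g → mulLinear^ c r f ≗ mulLinear^ c r g
mulLinear^-cong c zero    e = e
mulLinear^-cong c (suc r) e =
  mulLinear^-cong c r λ j → cong₂ (λ x y → x + c * y) (e j) (shift-cong e j)

-- The number of extensions of an independent set into a pendant K₂ whose attachment vertex
-- is (true) or is not (false) in the set; hence the factor 1 + x or 1 + 2x.
k₂Choices : Bool → ℕ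
k₂Choices true  = 1
k₂Choices false = 2

wellFormed-attachK₂ : ∀ {g v} → WellFormed g → v < n g → WellFormed (attachPath g v 2)
wellFormed-attachK₂ {g} wf v<n = wellFormed-addLeaf (wellFormed-addLeaf wf v<n) (n<1+n (n g))

indepCountWith-attachK₂ : ∀ {g v b β} → WellFormed g → v < n g → ConstraintsBelow (n g) β → (v , b) ∈ β →
  ∀ j → indepCountWith (attachPath g v 2) β j ≡ mulLinear (k₂Choices b) (indepCountWith g β) j
indepCountWith-attachK₂ {g} {v} {b} {β} wf v<n ok v∈β j = begin
  indepCountWith (addLeaf (addLeaf g v) (n g)) β j
    ≡⟨ indepCountWith-addLeaf (wellFormed-addLeaf wf v<n) (n<1+n (n g)) ok′ j ⟩
  shift (indepCountWith (addLeaf g v) ((n g , false) ∷ β)) j + indepCountWith (addLeaf g v) β j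
    ≡⟨ cong₂ _+_ (shift-cong (indepCountWith-addLeaf-excluded wf v<n ok) j)
                 (indepCountWith-addLeaf wf v<n ok j) ⟩
  shift D j + (shift Dᵥ j + D j)
    ≡⟨ trans (sym (+-assoc (shift D j) (shift Dᵥ j) (D j))) (+-comm _ (D j)) ⟩
  D j + (shift D j + shift Dᵥ j)
    ≡⟨ cong (D j +_) (choices b v∈β) ⟩
  D j + k₂Choices b * shift D j ∎
  where
  open ≡-Reasoning
  D Dᵥ : ℕ → ℕ
  D  = indepCountWith g β
  Dᵥ = indepCountWith g ((v , false) ∷ β)
  ok′ : ConstraintsBelow (n (addLeaf g v)) β
  ok′ = All.map m<n⇒m<1+n ok
  choices : ∀ b → (v , b) ∈ β → shift D j + shift Dᵥ j ≡ k₂Choices b * shift D j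
  choices true v∈β = begin
    shift D j + shift Dᵥ j ≡⟨ cong (shift D j +_) (shift-zero (indepCountWith-conflict g v∈β) j) ⟩
    shift D j + 0          ≡⟨ +-identityʳ _ ⟩
    shift D j              ≡⟨ *-identityˡ _ ⟨
    1 * shift D j          ∎
  choices false v∈β = begin
    shift D j + shift Dᵥ j ≡⟨ cong (shift D j +_) (shift-cong (indepCountWith-redundant g v∈β) j) ⟩
    shift D j + shift D j  ≡⟨ cong (shift D j +_) (+-identityʳ _) ⟨
    2 * shift D j          ∎

indepCountWith-attachK₂s : ∀ {g v b β} → WellFormed g → v < n g → ConstraintsBelow (n g) β → (v , b) ∈ β →
  ∀ r j → indepCountWith (attachPaths g v r 2) β j ≡ mulLinear^ (k₂Choices b) r (indepCountWith g β) j
indepCountWith-attachK₂s wf v<n ok v∈β zero    j = refl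
indepCountWith-attachK₂s {b = b} wf v<n ok v∈β (suc r) j =
  trans (indepCountWith-attachK₂s (wellFormed-attachK₂ wf v<n) (m<n⇒m<1+n (m<n⇒m<1+n v<n))
                                  (All.map (m<n⇒m<1+n ∘ m<n⇒m<1+n) ok) v∈β r j)
        (mulLinear^-cong (k₂Choices b) r (indepCountWith-attachK₂ wf v<n ok v∈β) j)

wellFormed-attachK₂s : ∀ {g v} r → WellFormed g → v < n g → WellFormed (attachPaths g v r 2)
wellFormed-attachK₂s zero    wf v<n = wf
wellFormed-attachK₂s (suc r) wf v<n =
  wellFormed-attachK₂s r (wellFormed-attachK₂ wf v<n) (m<n⇒m<1+n (m<n⇒m<1+n v<n))

n-attachK₂s : ∀ {g v} r → n g ≤ n (attachPaths g v r 2)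
n-attachK₂s zero    = ≤-refl
n-attachK₂s {g} (suc r) = ≤-trans (m≤n+m (n g) 2) (n-attachK₂s r)

-- Top coefficients

record TopCoeffs (h : ℕ) (f : ℕ → ℕ) (a x z : ℕ) : Set where
  field
    vanish : ∀ j → 3 + h ≤ j → f j ≡ 0
    lead   : f (2 + h) ≡ a
    next   : f (1 + h) ≡ x
    third  : z ≤ f h
open TopCoeffs

topCoeffs-resp : ∀ {h f g a x z} → f ≗ g → TopCoeffs h f a x z → TopCoeffs h g a x z
topCoeffs-resp f≗g t = record
  { vanish = λ j h<j → trans (sym (f≗g j)) (vanish t j h<j)
  ; lead   = trans (sym (f≗g _)) (lead t)
  ; next   = trans (sym (f≗g _)) (next t)
  ; third  = ≤-trans (third t) (≤-reflexive (f≗g _))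
  }

topCoeffs-adjust : ∀ {h f a x z a′ x′ z′} → TopCoeffs h f a x z → a ≡ a′ → x ≡ x′ → z′ ≤ z →
  TopCoeffs h f a′ x′ z′
topCoeffs-adjust t refl refl z′≤z =
  record { vanish = vanish t ; lead = lead t ; next = next t ; third = ≤-trans z′≤z (third t) }

topCoeffs-+ : ∀ {h f g a x z a′ x′ z′} → TopCoeffs h f a x z → TopCoeffs h g a′ x′ z′ →
  TopCoeffs h (λ j → f j + g j) (a + a′) (x + x′) (z + z′)
topCoeffs-+ t u = record
  { vanish = λ j h<j → cong₂ _+_ (vanish t j h<j) (vanish u j h<j)
  ; lead   = cong₂ _+_ (lead t) (lead u)
  ; next   = cong₂ _+_ (next t) (next u)
  ; third  = +-mono-≤ (third t) (third u)
  }

topCoeffs-mulLinear : ∀ {h f a x z} c → TopCoeffs h f a x z →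
  TopCoeffs (suc h) (mulLinear c f) (c * a) (a + c * x) (x + c * z)
topCoeffs-mulLinear {h} c t = record
  { vanish = λ { (suc j) h<j → trans (cong₂ (λ y w → y + c * w) (vanish t (suc j) (m≤n⇒m≤1+n (s≤s⁻¹ h<j)))
                                                                (vanish t j (s≤s⁻¹ h<j)))
                                      (*-zeroʳ c) }
  ; lead   = cong₂ (λ y w → y + c * w) (vanish t (3 + h) ≤-refl) (lead t)
  ; next   = cong₂ (λ y w → y + c * w) (lead t) (next t)
  ; third  = +-mono-≤ (≤-reflexive (sym (next t))) (*-monoʳ-≤ c (third t))
  }

topCoeffs-suc : ∀ {r h f a x z} → TopCoeffs (r + suc h) f a x z → TopCoeffs (suc r + h) f a x z
topCoeffs-suc {r} {h} {f} {a} {x} {z} = subst (λ h′ → TopCoeffs h′ f a x z) (+-suc r h)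

topCoeffs-mulLinear^-c≡1 : ∀ {h f a x z} r → TopCoeffs h f a x z →
  TopCoeffs (r + h) (mulLinear^ 1 r f) a (x + r * a) (z + r * x)
topCoeffs-mulLinear^-c≡1 {x = x} {z} zero t =
  topCoeffs-adjust t refl (sym (+-identityʳ x)) (≤-reflexive (+-identityʳ z))
topCoeffs-mulLinear^-c≡1 {a = a} {x} {z} (suc r) t =
  topCoeffs-suc (topCoeffs-adjust (topCoeffs-mulLinear^-c≡1 r (topCoeffs-mulLinear 1 t)) (*-identityˡ a) (nextEq a x r)
                                  (≤-trans (m≤m+n _ (r * a)) (≤-reflexive (thirdEq a x z r))))
  where
  nextEq : ∀ a x r → (a + 1 * x) + r * (1 * a) ≡ x + suc r * a
  nextEq = solve-∀
  thirdEq : ∀ a x z r → (z + suc r * x) + r * a ≡ (x + 1 * z) + r * (a + 1 * x)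
  thirdEq = solve-∀

topCoeffs-mulLinear^-a≡0 : ∀ {h f x z} c r → TopCoeffs h f 0 x z →
  TopCoeffs (r + h) (mulLinear^ c r f) 0 (c ^ r * x) (c ^ r * z)
topCoeffs-mulLinear^-a≡0 {x = x} {z} c zero t =
  topCoeffs-adjust t refl (sym (*-identityˡ x)) (≤-reflexive (*-identityˡ z))
topCoeffs-mulLinear^-a≡0 {x = x} {z} c (suc r) t =
  topCoeffs-suc (topCoeffs-adjust (topCoeffs-mulLinear^-a≡0 c r step) refl (powStep x)
                                  (≤-reflexive (sym (powStep z))))
  where
  step = topCoeffs-adjust (topCoeffs-mulLinear c t) (*-zeroʳ c) refl (m≤n+m (c * z) x)
  powStep : ∀ y → c ^ r * (c * y) ≡ c ^ suc r * y
  powStep y = trans (sym (*-assoc (c ^ r) c y)) (cong (_* y) (*-comm (c ^ r) c))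

nextCoeff : ℕ → ℕ → ℕ → ℕ
nextCoeff k p q = 20 + 2 * k + p + q

thirdCoeff : ℕ → ℕ → ℕ → ℕ
thirdCoeff k p q = 36 + 17 * k + (k + 3) * (17 + k) + (17 + k) * q + (20 + k) * p + 13 * p * q

-- treeG k is H with k pendant K₂'s attached at v₂ = 2 and k + 3 at v₃ = 3.
H : Graph
H = attachPaths (attachPath star 1 4) 1 2 2

independent-H-size : ∀ S → isIndependent H S ≡ true → ∣ S ∣ ≤ 7
independent-H-size S ind with ∣ S ∣ ≤? 7
... | yes ≤7 = ≤7
... | no  ≰7 = contradiction (S , ind , ≰7)
                (from-no (anySubset? λ S → (isIndependent H S Bool.≟ true) ×-dec ¬? (∣ S ∣ ≤? 7)))

pinned : Bool → Bool → List (ℕ × Bool)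
pinned b₂ b₃ = (3 , b₃) ∷ (2 , b₂) ∷ []

vanish-H : ∀ β j → 8 ≤ j → indepCountWith H β j ≡ 0
vanish-H β j 8≤j = countOfSize-above _ j small
  where
  small : ∀ S → isIndependent H S ∧ satisfies S β ≡ true → ∣ S ∣ < j
  small S sat with isIndependent H S in ind
  ... | true  = <-≤-trans (s≤s (independent-H-size S ind)) 8≤j
  ... | false = contradiction sat λ ()

topCoeffs-H-TT : TopCoeffs 5 (indepCountWith H (pinned true true)) 1 17 36
topCoeffs-H-TT = record { vanish = vanish-H (pinned true true) ; lead = refl ; next = refl ; third = ≤-refl }

topCoeffs-H-TF : TopCoeffs 5 (indepCountWith H (pinned true false)) 0 1 17
topCoeffs-H-TF = record { vanish = vanish-H (pinned true false) ; lead = refl ; next = refl ; third = ≤-refl }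

topCoeffs-H-FT : TopCoeffs 5 (indepCountWith H (pinned false true)) 0 1 17
topCoeffs-H-FT = record { vanish = vanish-H (pinned false true) ; lead = refl ; next = refl ; third = ≤-refl }

topCoeffs-H-FF : TopCoeffs 5 (indepCountWith H (pinned false false)) 0 0 13
topCoeffs-H-FF = record { vanish = vanish-H (pinned false false) ; lead = refl ; next = refl ; third = ≤-refl }

wellFormed-H : WellFormed H
wellFormed-H = from-yes (All.all? (λ (i , j) → (i <? 12) ×-dec (j <? 12)) (E H))

pinned-below-H : ∀ b₂ b₃ → ConstraintsBelow (n H) (pinned b₂ b₃)
pinned-below-H b₂ b₃ = from-yes (All.all? (λ (v , _) → v <? 12) (pinned b₂ b₃))

part : ℕ → Bool → Bool → ℕ → ℕ
part k b₂ b₃ = indepCountWith (treeG k) (pinned b₂ b₃)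

part≡ : ∀ k b₂ b₃ j →
  part k b₂ b₃ j
    ≡ mulLinear^ (k₂Choices b₃) (k + 3) (mulLinear^ (k₂Choices b₂) k (indepCountWith H (pinned b₂ b₃))) j
part≡ k b₂ b₃ j =
  trans (indepCountWith-attachK₂s (wellFormed-attachK₂s k wellFormed-H 2<n) (<-≤-trans 3<n grows)
                                  (All.map (λ v<n → <-≤-trans v<n grows) (pinned-below-H b₂ b₃)) (here refl) (k + 3) j)
        (mulLinear^-cong _ (k + 3)
          (indepCountWith-attachK₂s wellFormed-H 2<n (pinned-below-H b₂ b₃) (there (here refl)) k) j)
  where
  2<n : 2 < n H
  2<n = <ᵇ⇒< 2 12 _
  3<n : 3 < n H
  3<n = <ᵇ⇒< 3 12 _
  grows : n H ≤ n (attachPaths H 2 k 2)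
  grows = n-attachK₂s k

module _ (k : ℕ) where

  private
    p q : ℕ
    p = 2 ^ k
    q = 2 ^ (k + 3)

  topCoeffs-part-TT : TopCoeffs ((k + 3) + (k + 5)) (part k true true)
                                1 (20 + 2 * k) (36 + 17 * k + (k + 3) * (17 + k))
  topCoeffs-part-TT = topCoeffs-resp (λ j → sym (part≡ k true true j))
    (topCoeffs-adjust (topCoeffs-mulLinear^-c≡1 (k + 3) (topCoeffs-mulLinear^-c≡1 k (topCoeffs-H-TT)))
                      refl (nextEq k) (≤-reflexive (thirdEq k)))
    where
    nextEq : ∀ k → (17 + k * 1) + (k + 3) * 1 ≡ 20 + 2 * k
    nextEq = solve-∀
    thirdEq : ∀ k → 36 + 17 * k + (k + 3) * (17 + k) ≡ (36 + k * 17) + (k + 3) * (17 + k * 1)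
    thirdEq = solve-∀

  topCoeffs-part-TF : TopCoeffs ((k + 3) + (k + 5)) (part k true false) 0 q ((17 + k) * q)
  topCoeffs-part-TF = topCoeffs-resp (λ j → sym (part≡ k true false j))
    (topCoeffs-adjust (topCoeffs-mulLinear^-a≡0 2 (k + 3) (topCoeffs-mulLinear^-c≡1 k topCoeffs-H-TF))
                      refl (nextEq k q) (≤-reflexive (thirdEq k q)))
    where
    nextEq : ∀ k q → q * (1 + k * 0) ≡ q
    nextEq = solve-∀
    thirdEq : ∀ k q → (17 + k) * q ≡ q * (17 + k * 1)
    thirdEq = solve-∀

  topCoeffs-part-FT : TopCoeffs ((k + 3) + (k + 5)) (part k false true) 0 p ((20 + k) * p)
  topCoeffs-part-FT = topCoeffs-resp (λ j → sym (part≡ k false true j))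
    (topCoeffs-adjust (topCoeffs-mulLinear^-c≡1 (k + 3) (topCoeffs-mulLinear^-a≡0 2 k topCoeffs-H-FT))
                      refl (nextEq k p) (≤-reflexive (thirdEq k p)))
    where
    nextEq : ∀ k p → p * 1 + (k + 3) * 0 ≡ p
    nextEq = solve-∀
    thirdEq : ∀ k p → (20 + k) * p ≡ p * 17 + (k + 3) * (p * 1)
    thirdEq = solve-∀

  topCoeffs-part-FF : TopCoeffs ((k + 3) + (k + 5)) (part k false false) 0 0 (13 * p * q)
  topCoeffs-part-FF = topCoeffs-resp (λ j → sym (part≡ k false false j))
    (topCoeffs-adjust (topCoeffs-mulLinear^-a≡0 2 (k + 3) (topCoeffs-mulLinear^-a≡0 2 k topCoeffs-H-FF))
                      refl (nextEq p q) (≤-reflexive (thirdEq p q)))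
    where
    nextEq : ∀ p q → q * (p * 0) ≡ 0
    nextEq = solve-∀
    thirdEq : ∀ p q → 13 * p * q ≡ q * (p * 13)
    thirdEq = solve-∀

  topCoeffs-tree : TopCoeffs ((k + 3) + (k + 5)) (indepCount (treeG k)) 1 (nextCoeff k p q) (thirdCoeff k p q)
  topCoeffs-tree = topCoeffs-resp (λ j → sym (split j))
    (topCoeffs-adjust (topCoeffs-+ (topCoeffs-+ topCoeffs-part-TT topCoeffs-part-TF)
                                   (topCoeffs-+ topCoeffs-part-FT topCoeffs-part-FF))
                      refl (nextEq k p q) (≤-reflexive (thirdEq k p q)))
    where
    split : ∀ j → indepCount (treeG k) j
                ≡ (part k true true j + part k true false j) + (part k false true j + part k false false j)
    split j =
      trans (indepCount≡indepCountWith[] (treeG k) j)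
        (trans (indepCountWith-condition (treeG k) [] 2 j)
               (cong₂ _+_ (indepCountWith-condition (treeG k) ((2 , true) ∷ []) 3 j)
                          (indepCountWith-condition (treeG k) ((2 , false) ∷ []) 3 j)))
    nextEq : ∀ k p q → ((20 + 2 * k) + q) + (p + 0) ≡ 20 + 2 * k + p + q
    nextEq = solve-∀
    thirdEq : ∀ k p q → 36 + 17 * k + (k + 3) * (17 + k) + (17 + k) * q + (20 + k) * p + 13 * p * q
                      ≡ ((36 + 17 * k + (k + 3) * (17 + k)) + (17 + k) * q) + ((20 + k) * p + 13 * p * q)
    thirdEq = solve-∀

gap : ℕ → ℕ → ℕ
gap m r = 362 + 6784 * r + 5888 * r * r + 6285 * m + 11344 * m * r + 5453 * m * m

-- With k = 4 + m and 2^k = 16 (1 + m + r), the gap is a polynomial with positive coefficients.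
thirdCoeff-expansion : ∀ m r → let k = 4 + m ; p = 16 * (suc m + r) ; q = p * 8 in
  thirdCoeff k p q ≡ nextCoeff k p q * nextCoeff k p q + suc (gap m r)
thirdCoeff-expansion = expand
  where
  expand : ∀ m r →
    36 + 17 * (4 + m) + (4 + m + 3) * (17 + (4 + m)) + (17 + (4 + m)) * (16 * (suc m + r) * 8)
      + (20 + (4 + m)) * (16 * (suc m + r)) + 13 * (16 * (suc m + r)) * (16 * (suc m + r) * 8)
    ≡ (20 + 2 * (4 + m) + 16 * (suc m + r) + 16 * (suc m + r) * 8)
        * (20 + 2 * (4 + m) + 16 * (suc m + r) + 16 * (suc m + r) * 8)
      + suc (362 + 6784 * r + 5888 * r * r + 6285 * m + 11344 * m * r + 5453 * m * m)
  expand = solve-∀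

n<2^n : ∀ n → n < 2 ^ n
n<2^n zero    = s≤s z≤n
n<2^n (suc n) = +-mono-≤ (m^n>0 2 n) (≤-trans (n<2^n n) (m≤m+n (2 ^ n) 0))

nextCoeff²<thirdCoeff : ∀ k → 4 ≤ k →
  nextCoeff k (2 ^ k) (2 ^ (k + 3)) * nextCoeff k (2 ^ k) (2 ^ (k + 3)) < thirdCoeff k (2 ^ k) (2 ^ (k + 3))
nextCoeff²<thirdCoeff k@(suc (suc (suc (suc m)))) (s≤s (s≤s (s≤s (s≤s z≤n)))) =
  subst₂ (λ p q → nextCoeff k p q * nextCoeff k p q < thirdCoeff k p q) (sym p≡) (sym q≡)
         (subst (nextCoeff k P Q * nextCoeff k P Q <_) (sym (thirdCoeff-expansion m r)) (m<m+n _ (s≤s z≤n)))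
  where
  r P Q : ℕ
  r = 2 ^ m ∸ suc m
  P = 16 * (suc m + r)
  Q = P * 8
  p≡ : 2 ^ k ≡ P
  p≡ = trans (^-distribˡ-+-* 2 4 m) (cong (16 *_) (sym (m+[n∸m]≡n (n<2^n m))))
  q≡ : 2 ^ (k + 3) ≡ Q
  q≡ = trans (^-distribˡ-+-* 2 k 3) (cong (_* 8) p≡)

mainTheorem4 : (k : ℕ) → 4 ≤ k → ¬ LogConcave (indepPoly (treeG k))
mainTheorem4 k 4≤k = ¬logConcave-indepPoly (treeG k) ((k + 3) + (k + 5)) (begin-strict
  s (1 + h) * s (1 + h)   ≡⟨ cong₂ _*_ (next top) (next top) ⟩
  nextCoeff k p q * nextCoeff k p q <⟨ nextCoeff²<thirdCoeff k 4≤k ⟩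
  thirdCoeff k p q        ≤⟨ third top ⟩
  s h                     ≡⟨ *-identityʳ (s h) ⟨
  s h * 1                 ≡⟨ cong (s h *_) (lead top) ⟨
  s h * s (2 + h)         ∎)
  where
  open ≤-Reasoning
  h p q : ℕ
  h = (k + 3) + (k + 5)
  p = 2 ^ k
  q = 2 ^ (k + 3)
  s : ℕ → ℕ
  s = indepCount (treeG k)
  top : TopCoeffs h s 1 (nextCoeff k p q) (thirdCoeff k p q)
  top = topCoeffs-tree k
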